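{- Let $k$ be an integer with $1<k\le 5$, or $k=7$, or $k=9$. The $k$-simplex numbers are $\binom{m+k-1}{k}$ for positive integers $m$. For a positive integer $n$ put $s=\left\lfloor\sqrt[k]{k!\,n}\right\rfloor$ and $t=\left\lfloor\frac{k}{2}\right\rfloor$. Then the $n$-th smallest positive integer that is not a $k$-simplex number equals $$a(n)=\begin{cases} n+s-t+2 & \text{if } n+s-t+1\ge\binom{s+\lceil k/2\rceil+1}{k},\\ n+s-t & \text{if } n+s-t<\binom{s+\lceil k/2\rceil}{k},\\ n+s-t+1 & \text{otherwise.}\end{cases}$$ -}

module Defs where

open import Data.Nat using (ℕ; zero; suc; _+_; _*_; _∸_; _^_; _≤_; _<_; _/_; _!)
open import Data.Nat.Combinatorics using (_C_)
open import Data.Fin using (Fin; toℕ)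
open import Data.Product using (Σ; ∃; _×_; _,_)
open import Relation.Binary.PropositionalEquality using (_≡_)
open import Relation.Nullary using (¬_)

IsSimplex : ℕ → ℕ → Set
IsSimplex k x = ∃ λ m → 1 ≤ m × x ≡ (m + k ∸ 1) C k

NonSimplex : ℕ → ℕ → Set
NonSimplex k x = 1 ≤ x × ¬ IsSimplex k x

-- a is the n-th smallest (n ≥ 1) positive non-k-simplex integer:
-- a is such a number, and the such numbers ≤ a are enumerated by a strictly
-- increasing f : Fin n → ℕ (so there are exactly n of them, the largest being a).
IsNthNonSimplex : ℕ → ℕ → ℕ → Set
IsNthNonSimplex k n a =
  NonSimplex k a ×
  Σ (Fin n → ℕ) λ f →
    (∀ i j → toℕ i < toℕ j → f i < f j) ×
    (∀ i → NonSimplex k (f i) × f i ≤ a) ×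
    (∀ x → NonSimplex k x → x ≤ a → ∃ λ i → f i ≡ x)

IsFloorRoot : ℕ → ℕ → ℕ → Set
IsFloorRoot k y s = s ^ k ≤ y × y < suc s ^ k

-- Write σ m = C(m+k-1, k). As σ is strictly increasing with σ 0 = 0, exactly x - j of the
-- numbers 1, …, x are non-simplex when σ j ≤ x < σ (j+1), so the n-th non-simplex number is n + j
-- for the unique j with σ j < n + j < σ (j+1).
-- Put J = s - t. Since k! σ m = m (m+1) ⋯ (m+k-1), the bounds s^k ≤ k! n < (s+1)^k together with
-- m (m+1) ⋯ (m+k-1) ≤ (m+t)^k and (m+t+1)^k + k! (m+2) ≤ (m+3) (m+4) ⋯ (m+k+2) give
-- σ J < n + J and n + J + 2 < σ (J+3), so j ∈ {J, J+1, J+2}, and the three cases of the formula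
-- say which. For the listed k both polynomial inequalities hold coefficientwise.

{-# OPTIONS --safe #-}
module Submission where

open import Defs
open import Data.Bool.Base using (Bool; true; false; T; _∧_; if_then_else_)
open import Data.Bool.Properties using (T-∧)
open import Data.Empty using (⊥-elim)
open import Data.Fin.Base using (Fin; toℕ; fromℕ; inject₁; lower₁)
open import Data.Fin.Properties
  using (¬Fin0; toℕ-fromℕ; toℕ-inject₁; toℕ-injective; inject₁ℕ<; inject₁-lower₁; ≤fromℕ)
open import Data.List.Base using (List; []; _∷_; map)
open import Data.Nat.Base
open import Data.Nat.Properties
open import Data.Nat.Combinatorics using (_C_; nCn≡1; nCk+nC[k+1]≡[n+1]C[k+1])
open import Data.Nat.Combinatorics.Specification using (k>n⇒nCk≡0)
open import Data.Nat.Tactic.RingSolver using (solve-∀)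
open import Data.Product.Base using (Σ; ∃; _×_; _,_; proj₁; proj₂)
open import Data.Sum.Base using (_⊎_; inj₁; inj₂)
open import Function.Base using (_∘_)
open import Function.Bundles using (Equivalence)
open import Relation.Binary.Definitions using (tri<; tri≈; tri>)
open import Relation.Binary.PropositionalEquality
open import Relation.Nullary using (¬_; yes; no; does)
open import Relation.Nullary.Decidable using (dec-true; dec-false; map′; _×-dec_; ¬?)
open import Relation.Unary using (Decidable)

infixl 8 _↑_
_↑_ : ℕ → ℕ → ℕ
m ↑ zero = 1
m ↑ suc k = m * (suc m ↑ k)

↑-suc-tail : ∀ m k → m ↑ suc k ≡ m ↑ k * (m + k)
↑-suc-tail m zero = unit m
  where
  unit : ∀ m → m * 1 ≡ 1 * (m + 0)
  unit = solve-∀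
↑-suc-tail m (suc k) = trans (cong (m *_) (↑-suc-tail (suc m) k)) (reassoc m (suc m ↑ k) k)
  where
  reassoc : ∀ m u k → m * (u * (suc m + k)) ≡ m * u * (m + suc k)
  reassoc = solve-∀

1↑k≡k! : ∀ k → 1 ↑ k ≡ k !
1↑k≡k! zero = refl
1↑k≡k! (suc k) = trans (↑-suc-tail 1 k) (trans (cong (_* suc k) (1↑k≡k! k)) (*-comm (k !) (suc k)))

simplex : ℕ → ℕ → ℕ
simplex k m = (m + k ∸ 1) C k

k!*simplex≡↑ : ∀ m k → k ! * simplex k (suc m) ≡ suc m ↑ k
k!*simplex≡↑ m zero = refl
k!*simplex≡↑ zero (suc k) = begin
  suc k ! * (suc k C suc k) ≡⟨ cong (suc k ! *_) (nCn≡1 (suc k)) ⟩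
  suc k ! * 1               ≡⟨ *-identityʳ (suc k !) ⟩
  suc k !                   ≡⟨ sym (1↑k≡k! (suc k)) ⟩
  1 ↑ suc k                 ∎
  where open ≡-Reasoning
k!*simplex≡↑ (suc m) (suc k) = begin
  suc k ! * (suc n C suc k)                 ≡⟨ cong (suc k ! *_) (sym (nCk+nC[k+1]≡[n+1]C[k+1] n k)) ⟩
  suc k ! * (n C k + n C suc k)             ≡⟨ *-distribˡ-+ (suc k !) (n C k) (n C suc k) ⟩
  suc k ! * (n C k) + suc k ! * (n C suc k)
    ≡⟨ cong (_+ suc k ! * (n C suc k)) (*-assoc (suc k) (k !) (n C k)) ⟩
  suc k * (k ! * (n C k)) + suc k ! * (n C suc k)
    ≡⟨ cong (λ i → suc k * (k ! * (i C k)) + suc k ! * (n C suc k)) (+-suc m k) ⟩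
  suc k * (k ! * ((suc m + k) C k)) + suc k ! * (n C suc k)
    ≡⟨ cong₂ (λ x y → suc k * x + y) (k!*simplex≡↑ (suc m) k) (k!*simplex≡↑ m (suc k)) ⟩
  suc k * u + suc m * u                     ≡⟨ collect k m u ⟩
  u * (suc (suc m) + k)                     ≡⟨ sym (↑-suc-tail (suc (suc m)) k) ⟩
  suc (suc m) ↑ suc k                       ∎
  where
  open ≡-Reasoning
  n u : ℕ
  n = m + suc k
  u = suc (suc m) ↑ k
  collect : ∀ k m u → suc k * u + suc m * u ≡ u * (suc (suc m) + k)
  collect = solve-∀

0<nCk : ∀ {n k} → k ≤ n → 0 < n C k
0<nCk {k = zero} _ = z<s
0<nCk {suc n} {suc k} (s≤s k≤n) =
  subst (0 <_) (nCk+nC[k+1]≡[n+1]C[k+1] n k) (<-≤-trans (0<nCk k≤n) (m≤m+n _ _))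

simplex-0 : ∀ k → simplex (suc k) 0 ≡ 0
simplex-0 k = k>n⇒nCk≡0 (n<1+n k)

simplex-step : ∀ k m → simplex (suc k) m < simplex (suc k) (suc m)
simplex-step k zero = subst₂ _<_ (sym (simplex-0 k)) (sym (nCn≡1 (suc k))) z<s
simplex-step k (suc m) = subst (simplex (suc k) (suc m) <_) (nCk+nC[k+1]≡[n+1]C[k+1] (m + suc k) k)
  (m<n+m _ (0<nCk (≤-trans (n≤1+n k) (m≤n+m (suc k) m))))

-- Coefficient lists, constant term first.
Poly : Set
Poly = List ℕ

⟦_⟧ : Poly → ℕ → ℕ
⟦ [] ⟧ x = 0
⟦ a ∷ p ⟧ x = a + x * ⟦ p ⟧ x

infixl 6 _⊕_
_⊕_ : Poly → Poly → Poly
[] ⊕ q = q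
(a ∷ p) ⊕ [] = a ∷ p
(a ∷ p) ⊕ (b ∷ q) = a + b ∷ p ⊕ q

infixr 7 _⊛_
_⊛_ : ℕ → Poly → Poly
c ⊛ p = map (c *_) p

[x+_]*_ : ℕ → Poly → Poly
[x+ c ]* p = c ⊛ p ⊕ (0 ∷ p)

one : Poly
one = 1 ∷ []

⊕-eval : ∀ p q x → ⟦ p ⊕ q ⟧ x ≡ ⟦ p ⟧ x + ⟦ q ⟧ x
⊕-eval [] q x = refl
⊕-eval (a ∷ p) [] x = sym (+-identityʳ _)
⊕-eval (a ∷ p) (b ∷ q) x rewrite ⊕-eval p q x = interchange a b x (⟦ p ⟧ x) (⟦ q ⟧ x)
  where
  interchange : ∀ a b x u v → a + b + x * (u + v) ≡ a + x * u + (b + x * v)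
  interchange = solve-∀

⊛-eval : ∀ c p x → ⟦ c ⊛ p ⟧ x ≡ c * ⟦ p ⟧ x
⊛-eval c [] x = sym (*-zeroʳ c)
⊛-eval c (a ∷ p) x rewrite ⊛-eval c p x = distrib c a x (⟦ p ⟧ x)
  where
  distrib : ∀ c a x u → c * a + x * (c * u) ≡ c * (a + x * u)
  distrib = solve-∀

[x+]*-eval : ∀ c p x → ⟦ [x+ c ]* p ⟧ x ≡ (c + x) * ⟦ p ⟧ x
[x+]*-eval c p x rewrite ⊕-eval (c ⊛ p) (0 ∷ p) x | ⊛-eval c p x = sym (*-distribʳ-+ (⟦ p ⟧ x) c x)

one-eval : ∀ x → ⟦ one ⟧ x ≡ 1
one-eval x = cong suc (*-zeroʳ x)

infix 4 _≤ᶜ_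
_≤ᶜ_ : Poly → Poly → Bool
[] ≤ᶜ q = true
(a ∷ p) ≤ᶜ [] = false
(a ∷ p) ≤ᶜ (b ∷ q) = (a ≤ᵇ b) ∧ (p ≤ᶜ q)

≤ᶜ⇒eval-≤ : ∀ p q x → T (p ≤ᶜ q) → ⟦ p ⟧ x ≤ ⟦ q ⟧ x
≤ᶜ⇒eval-≤ [] q x _ = z≤n
≤ᶜ⇒eval-≤ (a ∷ p) (b ∷ q) x le with Equivalence.to T-∧ le
... | a≤b , p≤q = +-mono-≤ (≤ᵇ⇒≤ a b a≤b) (*-monoʳ-≤ x (≤ᶜ⇒eval-≤ p q x p≤q))

rising : ℕ → ℕ → Poly
rising c zero = one
rising c (suc k) = [x+ c ]* rising (suc c) k

power : ℕ → ℕ → Poly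
power c zero = one
power c (suc k) = [x+ c ]* power c k

rising-eval : ∀ c k x → ⟦ rising c k ⟧ x ≡ (c + x) ↑ k
rising-eval c zero x = one-eval x
rising-eval c (suc k) x rewrite [x+]*-eval c (rising (suc c) k) x | rising-eval (suc c) k x = refl

power-eval : ∀ c k x → ⟦ power c k ⟧ x ≡ (c + x) ^ k
power-eval c zero x = one-eval x
power-eval c (suc k) x rewrite [x+]*-eval c (power c k) x | power-eval c k x = refl

↑≤^-by-coefficients : ∀ k t → T (rising 0 k ≤ᶜ power t k) → ∀ u → u ↑ k ≤ (t + u) ^ k
↑≤^-by-coefficients k t le u =
  subst₂ _≤_ (rising-eval 0 k u) (power-eval t k u) (≤ᶜ⇒eval-≤ (rising 0 k) (power t k) u le)

^+≤↑-by-coefficients : ∀ k t → T (power (suc t) k ⊕ k ! ⊛ power 2 1 ≤ᶜ rising 3 k) →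
  ∀ u → (suc t + u) ^ k + k ! * (2 + u) ≤ (3 + u) ↑ k
^+≤↑-by-coefficients k t le u =
  subst₂ _≤_ lhs-eval (rising-eval 3 k u) (≤ᶜ⇒eval-≤ (power (suc t) k ⊕ k ! ⊛ power 2 1) (rising 3 k) u le)
  where
  lhs-eval : ⟦ power (suc t) k ⊕ k ! ⊛ power 2 1 ⟧ u ≡ (suc t + u) ^ k + k ! * (2 + u)
  lhs-eval = begin
    ⟦ power (suc t) k ⊕ k ! ⊛ power 2 1 ⟧ u
      ≡⟨ ⊕-eval (power (suc t) k) (k ! ⊛ power 2 1) u ⟩
    ⟦ power (suc t) k ⟧ u + ⟦ k ! ⊛ power 2 1 ⟧ u
      ≡⟨ cong₂ _+_ (power-eval (suc t) k u) (⊛-eval (k !) (power 2 1) u) ⟩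
    (suc t + u) ^ k + k ! * ⟦ power 2 1 ⟧ u
      ≡⟨ cong (λ v → (suc t + u) ^ k + k ! * v) (trans (power-eval 2 1 u) (^-identityʳ (2 + u))) ⟩
    (suc t + u) ^ k + k ! * (2 + u)
      ∎
    where open ≡-Reasoning

module Counting {p} {P : ℕ → Set p} (P? : Decidable P) where

  count : ℕ → ℕ
  count zero = 0
  count (suc x) = if does (P? (suc x)) then suc (count x) else count x

  count-yes : ∀ {x} → P (suc x) → count (suc x) ≡ suc (count x)
  count-yes {x} Px rewrite dec-true (P? (suc x)) Px = refl

  count-no : ∀ {x} → ¬ P (suc x) → count (suc x) ≡ count x
  count-no {x} ¬Px rewrite dec-false (P? (suc x)) ¬Px = refl

  count-const : ∀ {x y} → x ≤ y → (∀ {z} → x < z → z ≤ y → ¬ P z) → count y ≡ count x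
  count-const x≤y none with m≤n⇒m<n∨m≡n x≤y
  ... | inj₂ refl = refl
  ... | inj₁ (s≤s x≤y′) =
    trans (count-no (none (s≤s x≤y′) ≤-refl))
          (count-const x≤y′ λ x<z z≤y′ → none x<z (m≤n⇒m≤1+n z≤y′))

  Enumerates : ℕ → ℕ → Set p
  Enumerates n a =
    Σ (Fin n → ℕ) λ f →
      (∀ i j → toℕ i < toℕ j → f i < f j) ×
      (∀ i → P (f i) × f i ≤ a) ×
      (∀ x → P x → x ≤ a → ∃ λ i → f i ≡ x)

  largest : ∀ {n a} → Enumerates (suc n) a → ℕ
  largest {n} (f , _) = f (fromℕ n)

  ≤largest : ∀ {n a} (e : Enumerates (suc n) a) i → proj₁ e i ≤ largest e
  ≤largest {n} (f , mono , _) i with m≤n⇒m<n∨m≡n (≤fromℕ i)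
  ... | inj₁ i<last = <⇒≤ (mono i (fromℕ n) i<last)
  ... | inj₂ i≡last = ≤-reflexive (cong f (toℕ-injective i≡last))

  enumerates-init : ¬ P 0 → ∀ {n a} (e : Enumerates (suc n) a) → Enumerates n (pred (largest e))
  enumerates-init ¬P0 {n} (f , mono , into , onto) = f ∘ inject₁ , mono′ , into′ , onto′
    where
    m : ℕ
    m = f (fromℕ n)

    mono′ : ∀ i j → toℕ i < toℕ j → f (inject₁ i) < f (inject₁ j)
    mono′ i j i<j =
      mono (inject₁ i) (inject₁ j) (subst₂ _<_ (sym (toℕ-inject₁ i)) (sym (toℕ-inject₁ j)) i<j)

    into′ : ∀ i → P (f (inject₁ i)) × f (inject₁ i) ≤ pred m
    into′ i = proj₁ (into (inject₁ i)) , <⇒≤pred (mono (inject₁ i) (fromℕ n) inject₁<last)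
      where
      inject₁<last : toℕ (inject₁ i) < toℕ (fromℕ n)
      inject₁<last = subst (toℕ (inject₁ i) <_) (sym (toℕ-fromℕ n)) (inject₁ℕ< i)

    ¬≤pred : ∀ {y} → P y → ¬ y ≤ pred y
    ¬≤pred {zero} P0 _ = ¬P0 P0
    ¬≤pred {suc y} _ = <-irrefl refl

    onto′ : ∀ x → P x → x ≤ pred m → ∃ λ i → f (inject₁ i) ≡ x
    onto′ x Px x≤m-1 with onto x Px (≤-trans (≤pred⇒≤ x≤m-1) (proj₂ (into (fromℕ n))))
    ... | i , fi≡x = lower₁ i n≢i , trans (cong f (inject₁-lower₁ i n≢i)) fi≡x
      where
      n≢i : n ≢ toℕ i
      n≢i n≡i = ¬≤pred (proj₁ (into (fromℕ n))) (subst (_≤ pred m) x≡m x≤m-1)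
        where
        x≡m : x ≡ m
        x≡m = trans (sym fi≡x) (cong f (toℕ-injective (trans (sym n≡i) (sym (toℕ-fromℕ n)))))

  count-enumerates : ¬ P 0 → ∀ n {a} → Enumerates n a → count a ≡ n
  count-enumerates ¬P0 zero (f , _ , _ , onto) =
    count-const z≤n λ _ z≤a Pz → ¬Fin0 (proj₁ (onto _ Pz z≤a))
  count-enumerates ¬P0 (suc n) {a} e@(f , _ , into , onto) = begin
    count a                        ≡⟨ count-const (proj₂ (into (fromℕ n))) beyond-largest ⟩
    count (largest e)              ≡⟨ count-pred (proj₁ (into (fromℕ n))) ⟩
    suc (count (pred (largest e))) ≡⟨ cong suc (count-enumerates ¬P0 n (enumerates-init ¬P0 e)) ⟩
    suc n                          ∎
    where
    open ≡-Reasoning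

    count-pred : ∀ {x} → P x → count x ≡ suc (count (pred x))
    count-pred {zero} P0 = ⊥-elim (¬P0 P0)
    count-pred {suc x} Px = count-yes Px

    beyond-largest : ∀ {z} → largest e < z → z ≤ a → ¬ P z
    beyond-largest m<z z≤a Pz with onto _ Pz z≤a
    ... | i , refl = <⇒≱ m<z (≤largest e i)

-- For σ = simplex k, IsValue and NonValue are IsSimplex k and NonSimplex k, and
-- IsNthNonSimplex k n a is NonValue a × Enumerates n a.
module Gaps (σ : ℕ → ℕ) (σ-0 : σ 0 ≡ 0) (σ-step : ∀ m → σ m < σ (suc m)) where

  IsValue : ℕ → Set
  IsValue x = ∃ λ m → 1 ≤ m × x ≡ σ m

  NonValue : ℕ → Set
  NonValue x = 1 ≤ x × ¬ IsValue x

  σ-mono-< : ∀ {m m′} → m < m′ → σ m < σ m′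
  σ-mono-< {m} {suc m′} (s≤s m≤m′) with m≤n⇒m<n∨m≡n m≤m′
  ... | inj₁ m<m′ = <-trans (σ-mono-< m<m′) (σ-step m′)
  ... | inj₂ refl = σ-step m

  n≤σn : ∀ n → n ≤ σ n
  n≤σn zero = z≤n
  n≤σn (suc n) = ≤-trans (s≤s (n≤σn n)) (σ-step n)

  isValue? : Decidable IsValue
  isValue? x = map′
    (λ (m , _ , 1≤m , x≡σm) → m , 1≤m , x≡σm)
    (λ (m , 1≤m , x≡σm) → m , s≤s (subst (m ≤_) (sym x≡σm) (n≤σn m)) , 1≤m , x≡σm)
    (anyUpTo? (λ m → 1 ≤? m ×-dec x ≟ σ m) (suc x))

  nonValue? : Decidable NonValue
  nonValue? x = 1 ≤? x ×-dec ¬? (isValue? x)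

  open Counting nonValue? public

  ¬value-between : ∀ {j y} → σ j < y → y < σ (suc j) → ¬ IsValue y
  ¬value-between {j} σj<y y<σ[1+j] (m , _ , y≡σm) with <-cmp m j
  ... | tri< m<j _ _ = <-asym (σ-mono-< m<j) (subst (σ j <_) y≡σm σj<y)
  ... | tri≈ _ refl _ = <-irrefl (sym y≡σm) σj<y
  ... | tri> _ _ j<m = <⇒≱ y<σ[1+j] (subst (σ (suc j) ≤_) (sym y≡σm) (σ-mono-≤ j<m))
    where
    σ-mono-≤ : ∀ {m m′} → m ≤ m′ → σ m ≤ σ m′
    σ-mono-≤ m≤m′ with m≤n⇒m<n∨m≡n m≤m′
    ... | inj₁ m<m′ = <⇒≤ (σ-mono-< m<m′)
    ... | inj₂ refl = ≤-refl

  gapIndex : ∀ x → ∃ λ j → σ j ≤ x × x < σ (suc j)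
  gapIndex zero = 0 , ≤-reflexive σ-0 , subst (_< σ 1) σ-0 (σ-step 0)
  gapIndex (suc x) with gapIndex x
  ... | j , σj≤x , x<σ[1+j] with suc x <? σ (suc j)
  ...   | yes x+1<σ[1+j] = j , m≤n⇒m≤1+n σj≤x , x+1<σ[1+j]
  ...   | no x+1≮σ[1+j] = suc j , ≮⇒≥ x+1≮σ[1+j] , ≤-<-trans x<σ[1+j] (σ-step (suc j))

  count-in-gap : ∀ {x j} → σ j ≤ x → x < σ (suc j) → count x + j ≡ x
  count-in-gap {zero} {j} σj≤0 _ = n≤0⇒n≡0 (≤-trans (n≤σn j) σj≤0)
  count-in-gap {suc x} {j} σj≤1+x 1+x<σ[1+j] with σ j ≟ suc x
  ... | no σj≢1+x = begin
    count (suc x) + j ≡⟨ cong (_+ j) (count-yes (s≤s z≤n , ¬value-between σj<1+x 1+x<σ[1+j])) ⟩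
    suc (count x + j) ≡⟨ cong suc (count-in-gap (s≤s⁻¹ σj<1+x) (<-trans (n<1+n x) 1+x<σ[1+j])) ⟩
    suc x             ∎
    where
    open ≡-Reasoning
    σj<1+x : σ j < suc x
    σj<1+x = ≤∧≢⇒< σj≤1+x σj≢1+x
  count-in-gap {suc x} {zero} _ _ | yes σ0≡1+x = ⊥-elim (0≢1+n (trans (sym σ-0) σ0≡1+x))
  count-in-gap {suc x} {suc j} _ _ | yes σ[1+j]≡1+x = begin
    count (suc x) + suc j ≡⟨ cong (_+ suc j) (count-no λ (_ , ¬value) → ¬value (suc j , z<s , sym σ[1+j]≡1+x)) ⟩
    count x + suc j       ≡⟨ +-suc (count x) j ⟩
    suc (count x + j)     ≡⟨ cong suc (count-in-gap σj≤x (≤-reflexive (sym σ[1+j]≡1+x))) ⟩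
    suc x                 ∎
    where
    open ≡-Reasoning
    σj≤x : σ j ≤ x
    σj≤x = s≤s⁻¹ (subst (σ j <_) σ[1+j]≡1+x (σ-step j))

  InGap : ℕ → ℕ → Set
  InGap n j = σ j < n + j × n + j < σ (suc j)

  gap-after : ∀ {n i j} → i < j → n + i < σ (suc i) → n + j ≤ σ j
  gap-after {n} {i} {suc j} (s≤s i≤j) n+i<σ[1+i] with m≤n⇒m<n∨m≡n i≤j
  ... | inj₁ i<j =
    subst (_≤ σ (suc j)) (sym (+-suc n j)) (≤-trans (s≤s (gap-after i<j n+i<σ[1+i])) (σ-step j))
  ... | inj₂ refl = subst (_≤ σ (suc i)) (sym (+-suc n i)) n+i<σ[1+i]

  InGap-unique : ∀ {n i j} → InGap n i → InGap n j → i ≡ j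
  InGap-unique {i = i} {j} (σi< , <σ[1+i]) (σj< , <σ[1+j]) with <-cmp i j
  ... | tri< i<j _ _ = ⊥-elim (<⇒≱ σj< (gap-after i<j <σ[1+i]))
  ... | tri≈ _ i≡j _ = i≡j
  ... | tri> _ _ j<i = ⊥-elim (<⇒≱ σi< (gap-after j<i <σ[1+j]))

  nonValue≢σ : ∀ {a} → NonValue a → ∀ m → σ m ≢ a
  nonValue≢σ (1≤a , _) zero σ0≡a = <⇒≢ 1≤a (sym (trans (sym σ0≡a) σ-0))
  nonValue≢σ (_ , ¬value) (suc m) σ[1+m]≡a = ¬value (suc m , s≤s z≤n , sym σ[1+m]≡a)

  nth-nonValue≡ : ∀ {n a j} → NonValue a → Enumerates n a → InGap n j → a ≡ n + j
  nth-nonValue≡ {n} {a} nonValue enum n+j∈gap with gapIndex a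
  ... | j′ , σj′≤a , a<σ[1+j′] = trans a≡n+j′ (cong (n +_) (InGap-unique n+j′∈gap n+j∈gap))
    where
    a≡n+j′ : a ≡ n + j′
    a≡n+j′ = trans (sym (count-in-gap σj′≤a a<σ[1+j′])) (cong (_+ j′) (count-enumerates (λ ()) n enum))
    n+j′∈gap : InGap n j′
    n+j′∈gap =
      subst (λ y → σ j′ < y × y < σ (suc j′)) a≡n+j′ (≤∧≢⇒< σj′≤a (nonValue≢σ nonValue j′) , a<σ[1+j′])

-- t and c stand for ⌊k/2⌋ and ⌈k/2⌉; only c + t = k and the three inequalities are used.
module NthNonSimplex (k′ t c : ℕ) (c+t≡k : c + t ≡ suc k′)
  (t^k≤k! : t ^ suc k′ ≤ suc k′ !)
  (↑≤^ : ∀ u → u ↑ suc k′ ≤ (t + u) ^ suc k′)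
  (^+≤↑ : ∀ u → (suc t + u) ^ suc k′ + suc k′ ! * (2 + u) ≤ (3 + u) ↑ suc k′) where

  k : ℕ
  k = suc k′

  σ : ℕ → ℕ
  σ = simplex k

  open Gaps σ (simplex-0 k′) (simplex-step k′)

  private instance
    k!≢0 : NonZero (k !)
    k!≢0 = k !≢0

  t≤s : ∀ {n s} → 1 ≤ n → IsFloorRoot k (k ! * n) s → t ≤ s
  t≤s {n} 1≤n (_ , k!n<[1+s]^k) = ≮⇒≥ λ s<t → <⇒≱ k!n<[1+s]^k
    (≤-trans (^-monoˡ-≤ k s<t) (≤-trans t^k≤k! (m≤m*n (k !) n {{>-nonZero 1≤n}})))

  σ[J]<n+J : ∀ {n J} → 1 ≤ n → (t + J) ^ k ≤ k ! * n → σ J < n + J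
  σ[J]<n+J {n} {zero} 1≤n _ = subst (_< n + 0) (sym (simplex-0 k′)) (≤-trans 1≤n (m≤m+n n 0))
  σ[J]<n+J {n} {suc J} _ s^k≤k!n = ≤-<-trans (*-cancelˡ-≤ (k !) (begin
    k ! * σ (suc J) ≡⟨ k!*simplex≡↑ J k ⟩
    suc J ↑ k       ≤⟨ ↑≤^ (suc J) ⟩
    (t + suc J) ^ k ≤⟨ s^k≤k!n ⟩
    k ! * n         ∎)) (m<m+n n z<s)
    where open ≤-Reasoning

  n+[2+J]<σ[3+J] : ∀ {n J} → k ! * n < (suc t + J) ^ k → n + (2 + J) < σ (3 + J)
  n+[2+J]<σ[3+J] {n} {J} k!n<[1+s]^k = *-cancelˡ-< (k !) _ _ (begin-strict
    k ! * (n + (2 + J))              ≡⟨ *-distribˡ-+ (k !) n (2 + J) ⟩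
    k ! * n + k ! * (2 + J)          <⟨ +-monoˡ-< (k ! * (2 + J)) k!n<[1+s]^k ⟩
    (suc t + J) ^ k + k ! * (2 + J)  ≤⟨ ^+≤↑ J ⟩
    (3 + J) ↑ k                      ≡⟨ sym (k!*simplex≡↑ (2 + J) k) ⟩
    k ! * σ (3 + J)                  ∎)
    where open ≤-Reasoning

  [t+J+c]Ck≡σ[1+J] : ∀ J → (t + J + c) C k ≡ σ (1 + J)
  [t+J+c]Ck≡σ[1+J] J = cong (_C k) (trans (reorder t J c) (cong (J +_) c+t≡k))
    where
    reorder : ∀ t J c → t + J + c ≡ J + (c + t)
    reorder = solve-∀

  [t+J+c+1]Ck≡σ[2+J] : ∀ J → (t + J + c + 1) C k ≡ σ (2 + J)
  [t+J+c+1]Ck≡σ[2+J] J = cong (_C k) (trans (reorder t J c) (cong (λ i → suc (J + i)) c+t≡k))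
    where
    reorder : ∀ t J c → t + J + c + 1 ≡ suc (J + (c + t))
    reorder = solve-∀

  n+[t+J]+i≡n+[i+J]+t : ∀ n J i → n + (t + J) + i ≡ n + (i + J) + t
  n+[t+J]+i≡n+[i+J]+t n J i = reorder n t J i
    where
    reorder : ∀ n t J i → n + (t + J) + i ≡ n + (i + J) + t
    reorder = solve-∀

  formula : (n : ℕ) → 1 ≤ n → (s : ℕ) → IsFloorRoot k (k ! * n) s →
    (a : ℕ) → IsNthNonSimplex k n a →
      ((s + c + 1) C k + t ≤ n + s + 1 → a + t ≡ n + s + 2)
    × (n + s < (s + c) C k + t → a + t ≡ n + s)
    × ((s + c) C k + t ≤ n + s → n + s + 1 < (s + c + 1) C k + t → a + t ≡ n + s + 1)
  formula n 1≤n s FR a (nonsimplex , enum) with s ∸ t | m+[n∸m]≡n (t≤s 1≤n FR)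
  ... | J | refl = in-gap-2 , in-gap-0 , in-gap-1
    where
    nth≡ : ∀ {j} → InGap n j → a ≡ n + j
    nth≡ = nth-nonValue≡ nonsimplex enum

    shift : ∀ i → n + (t + J) + i ≡ n + (i + J) + t
    shift = n+[t+J]+i≡n+[i+J]+t n J

    shift₀ : n + (t + J) ≡ n + J + t
    shift₀ = trans (sym (+-identityʳ _)) (shift 0)

    ≤⇒<suc : ∀ {x} i → x ≤ n + (i + J) → x < n + (suc i + J)
    ≤⇒<suc i x≤ = ≤-trans (s≤s x≤) (≤-reflexive (sym (+-suc n (i + J))))

    in-gap-2 : (t + J + c + 1) C k + t ≤ n + (t + J) + 1 → a + t ≡ n + (t + J) + 2
    in-gap-2 h = trans (cong (_+ t) (nth≡ (≤⇒<suc 1 h′ , n+[2+J]<σ[3+J] (proj₂ FR)))) (sym (shift 2))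
      where
      h′ : σ (2 + J) ≤ n + (1 + J)
      h′ = +-cancelʳ-≤ t _ _ (subst₂ (λ x y → x + t ≤ y) ([t+J+c+1]Ck≡σ[2+J] J) (shift 1) h)

    in-gap-0 : n + (t + J) < (t + J + c) C k + t → a + t ≡ n + (t + J)
    in-gap-0 h = trans (cong (_+ t) (nth≡ (σ[J]<n+J 1≤n (proj₁ FR) , h′))) (sym shift₀)
      where
      h′ : n + J < σ (1 + J)
      h′ = +-cancelʳ-< t _ _ (subst₂ (λ x y → x < y + t) shift₀ ([t+J+c]Ck≡σ[1+J] J) h)

    in-gap-1 : (t + J + c) C k + t ≤ n + (t + J) → n + (t + J) + 1 < (t + J + c + 1) C k + t →
               a + t ≡ n + (t + J) + 1
    in-gap-1 h₁ h₂ = trans (cong (_+ t) (nth≡ (≤⇒<suc 0 h₁′ , h₂′))) (sym (shift 1))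
      where
      h₁′ : σ (1 + J) ≤ n + J
      h₁′ = +-cancelʳ-≤ t _ _ (subst₂ (λ x y → x + t ≤ y) ([t+J+c]Ck≡σ[1+J] J) shift₀ h₁)
      h₂′ : n + (1 + J) < σ (2 + J)
      h₂′ = +-cancelʳ-< t _ _ (subst₂ (λ x y → x < y + t) (shift 1) ([t+J+c+1]Ck≡σ[2+J] J) h₂)

theorem8 : (k : ℕ) → (k ≡ 2 ⊎ k ≡ 3 ⊎ k ≡ 4 ⊎ k ≡ 5 ⊎ k ≡ 7 ⊎ k ≡ 9) →
    (n : ℕ) → 1 ≤ n → (s : ℕ) → IsFloorRoot k ((k !) * n) s →
    (a : ℕ) → IsNthNonSimplex k n a →
    let t = k / 2
        c = (k + 1) / 2
    in (((s + c + 1) C k) + t ≤ n + s + 1 → a + t ≡ n + s + 2)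
     × (n + s < ((s + c) C k) + t → a + t ≡ n + s)
     × ((s + c) C k + t ≤ n + s → n + s + 1 < ((s + c + 1) C k) + t → a + t ≡ n + s + 1)
-- Each underscore is a comparison of explicit numbers or coefficient lists, settled by evaluation.
theorem8 _ (inj₁ refl) =
  NthNonSimplex.formula 1 1 1 refl (≤ᵇ⇒≤ _ _ _) (↑≤^-by-coefficients 2 1 _) (^+≤↑-by-coefficients 2 1 _)
theorem8 _ (inj₂ (inj₁ refl)) =
  NthNonSimplex.formula 2 1 2 refl (≤ᵇ⇒≤ _ _ _) (↑≤^-by-coefficients 3 1 _) (^+≤↑-by-coefficients 3 1 _)
theorem8 _ (inj₂ (inj₂ (inj₁ refl))) =
  NthNonSimplex.formula 3 2 2 refl (≤ᵇ⇒≤ _ _ _) (↑≤^-by-coefficients 4 2 _) (^+≤↑-by-coefficients 4 2 _)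
theorem8 _ (inj₂ (inj₂ (inj₂ (inj₁ refl)))) =
  NthNonSimplex.formula 4 2 3 refl (≤ᵇ⇒≤ _ _ _) (↑≤^-by-coefficients 5 2 _) (^+≤↑-by-coefficients 5 2 _)
theorem8 _ (inj₂ (inj₂ (inj₂ (inj₂ (inj₁ refl))))) =
  NthNonSimplex.formula 6 3 4 refl (≤ᵇ⇒≤ _ _ _) (↑≤^-by-coefficients 7 3 _) (^+≤↑-by-coefficients 7 3 _)
theorem8 _ (inj₂ (inj₂ (inj₂ (inj₂ (inj₂ refl))))) =
  NthNonSimplex.formula 8 4 5 refl (≤ᵇ⇒≤ _ _ _) (↑≤^-by-coefficients 9 4 _) (^+≤↑-by-coefficients 9 4 _)
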